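{- Let $n \ge 3$ and let $N = \{c_1, \dots, c_n, m_1, \dots, m_{n-1}\}$ be a set of $2n-1$ distinct elements. Let $G$ consist of the $n$ sets $\{c_1, c_n\}$ and $\{c_i, m_i, c_{i+1}\}$ for $i = 1, \dots, n-1$. In the game in which Black and White alternately claim previously unclaimed elements of $N$, Black moving first, until all of $N$ is claimed, White has a strategy guaranteeing that every set in $G$ contains at least one element claimed by White.
   Context: This is the "Cycle $C_n$ Configuration" of the paper. The elements of $N$ are called markers. The sets in $G$ are the traces on the markers of possible winning lines (groups) of a $k$-in-a-Row game, and they form a cycle: consecutive groups share a corner $c_i$. The group $\{c_1,c_n\}$ has only its two corners as markers, and every other group has one additional edge marker $m_i$. White guaranteeing a White element in every group means that Black cannot complete any of these groups. -}

module Defs where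

open import Data.Nat using (ℕ; zero; suc; pred; _%_)
open import Data.Fin using (Fin; zero; suc; inject₁; fromℕ; toℕ)
open import Data.Sum using (_⊎_; inj₁; inj₂)
open import Data.Product using (Σ; ∃; _×_; _,_)
open import Data.Empty using (⊥)
open import Data.List using (List; length; lookup; take)
open import Data.List.Membership.Propositional using (_∈_; _∉_)
open import Data.List.Relation.Unary.Unique.Propositional using (Unique)
open import Relation.Binary.PropositionalEquality using (_≡_)

-- Markers of the cycle configuration C_n:
--   inj₁ i  (i : Fin n)        is the corner c_{i+1}
--   inj₂ j  (j : Fin (n - 1))  is the edge marker m_{j+1}
-- These are 2n-1 pairwise distinct elements by construction.
Marker : ℕ → Set
Marker n = Fin n ⊎ Fin (pred n)

corner : ∀ {n} → Fin n → Marker n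
corner = inj₁

edge : ∀ {n} → Fin (pred n) → Marker n
edge = inj₂

-- For j : Fin (n-1) (i.e. edge marker m_{j+1}), the corners c_{j+1} and c_{j+2}.
loCorner : ∀ {n} → Fin (pred n) → Fin n
loCorner {suc n} j = inject₁ j

hiCorner : ∀ {n} → Fin (pred n) → Fin n
hiCorner {suc n} j = suc j

data Group (n : ℕ) : Set where
  closing  : Group n
  edgeGrp  : Fin (pred n) → Group n

_∈G_ : ∀ {n} → Marker n → Group n → Set
_∈G_ {zero}  x closing = ⊥
_∈G_ {suc k} x closing = x ≡ corner zero ⊎ x ≡ corner (fromℕ k)
x ∈G edgeGrp j = x ≡ corner (loCorner j) ⊎ (x ≡ edge j ⊎ x ≡ corner (hiCorner j))

-- A (partial) play is the chronological list of claimed markers.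
-- Position 0, 2, 4, ... are Black's moves (Black moves first),
-- positions 1, 3, 5, ... are White's moves.
Odd : ℕ → Set
Odd k = k % 2 ≡ 1

WhiteStrategy : ℕ → Set
WhiteStrategy n = List (Marker n) → Marker n

ConsistentWith : ∀ {n} → WhiteStrategy n → List (Marker n) → Set
ConsistentWith σ h = (k : Fin (length h)) → Odd (toℕ k) → lookup h k ≡ σ (take (toℕ k) h)

Legal : ∀ {n} → List (Marker n) → Set
Legal h = Unique h

Complete : ∀ {n} → List (Marker n) → Set
Complete {n} h = (x : Marker n) → x ∈ h

WhiteClaimed : ∀ {n} → List (Marker n) → Marker n → Set
WhiteClaimed h x = Σ (Fin (length h)) λ k → Odd (toℕ k) × lookup h k ≡ x

StrategyLegal : ∀ {n} → WhiteStrategy n → Set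
StrategyLegal {n} σ =
  (h : List (Marker n)) → Legal h → ConsistentWith σ h → Odd (length h) →
  (∃ λ (x : Marker n) → x ∉ h) → σ h ∉ h

StrategyWins : ∀ {n} → WhiteStrategy n → Set
StrategyWins {n} σ =
  (h : List (Marker n)) → Legal h → ConsistentWith σ h → Complete h →
  (g : Group n) → ∃ λ (x : Marker n) → x ∈G g × WhiteClaimed h x

module Submission where

-- White wins the Maker-Breaker game on the cycle configuration C_n by a
-- pairing strategy that depends on Black's first move x.
--
-- * White's first reply is a corner of the closing group {c_1, c_n} other
--   than x, which settles the closing group at once.
-- * Lay the markers out along the path c_1 m_1 c_2 m_2 ... m_{n-1} c_n
--   (position 2i for c_{i+1}, 2j+1 for m_{j+1}), delete x, and pair the
--   remaining 2n-2 markers consecutively.  Every edge group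
--   {c_j, m_j, c_{j+1}} occupies three consecutive positions, so it contains
--   one of these pairs.  Afterwards White answers every Black move by its mate.
-- * A generic pairing argument shows that White owns one marker of each pair:
--   of the two, whichever is claimed first is either White's, or is Black's
--   and then White takes the other one on the very next move.

open import Defs
open import Function using (_∘_)
open import Data.Nat using (ℕ; zero; suc; pred; _+_; _<_; _≤_; z≤n; s≤s; s≤s⁻¹)
open import Data.Nat.Properties using (<-cmp; <-trans; ≤-trans; ≤-refl; <⇒≤; n<1+n; <⇒≢; >⇒≢; suc-injective)
open import Data.Fin using (Fin; zero; suc; toℕ; fromℕ; fromℕ<; _≟_)
open import Data.Fin.Properties using (toℕ-injective; toℕ-fromℕ<; toℕ-inject₁; toℕ<n)
open import Data.Product using (Σ; ∃; _×_; _,_; proj₁; proj₂)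
open import Data.Sum as Sum using (_⊎_; inj₁; inj₂; [_,_]′; swap)
open import Data.Sum.Properties using (≡-dec)
open import Data.Empty using (⊥-elim)
open import Data.List using (List; []; _∷_; _++_; _∷ʳ_; length; lookup; take; map; allFin)
open import Data.List.Properties using (take-suc)
open import Data.List.Membership.Propositional using (_∈_; _∉_)
open import Data.List.Membership.Propositional.Properties using (∈-lookup; ∈-allFin; ∈-map⁺; ∈-++⁺ˡ; ∈-++⁺ʳ)
open import Data.List.Relation.Unary.Any as Any using (Any; here; there; index)
open import Data.List.Relation.Unary.Any.Properties using (lookup-index)
open import Data.List.Relation.Unary.All as All using ()
open import Data.List.Relation.Unary.AllPairs using (_∷_)
open import Data.List.Relation.Unary.Unique.Propositional using (Unique)
open import Relation.Binary using (tri<; tri≈; tri>)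
open import Relation.Binary.Definitions using (DecidableEquality)
open import Relation.Nullary using (yes; no)
open import Relation.Binary.PropositionalEquality
  using (_≡_; _≢_; refl; sym; trans; cong; subst; subst₂; module ≡-Reasoning)
open ≡-Reasoning

lookup-∉-take : ∀ {A : Set} {xs : List A} → Unique xs →
  (j : Fin (length xs)) {k : ℕ} → k ≤ toℕ j → lookup xs j ∉ take k xs
lookup-∉-take {xs = x ∷ xs} _ j {zero} _ ()
lookup-∉-take {xs = x ∷ xs} _ zero {suc k} ()
lookup-∉-take {xs = x ∷ xs} (x∉xs ∷ _) (suc j) {suc k} _ (here eq) =
  All.lookup x∉xs (∈-lookup j) (sym eq)
lookup-∉-take {xs = x ∷ xs} (_ ∷ distinct) (suc j) {suc k} (s≤s k≤j) (there p) =
  lookup-∉-take distinct j k≤j p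

data Turn (k : ℕ) : Set where
  black : Odd (suc k) → Turn k
  white : Odd k → Turn k

turn : (k : ℕ) → Turn k
turn zero = black refl
turn (suc zero) = white refl
turn (suc (suc k)) with turn k
... | black odd = black odd
... | white odd = white odd

module _ {n : ℕ} where

  _≟ᴹ_ : DecidableEquality (Marker n)
  _≟ᴹ_ = ≡-dec _≟_ _≟_

  open import Data.List.Membership.DecPropositional _≟ᴹ_ using (_∈?_)

  markers : List (Marker n)
  markers = map corner (allFin n) ++ map edge (allFin (pred n))

  ∈-markers : (y : Marker n) → y ∈ markers
  ∈-markers (inj₁ i) = ∈-++⁺ˡ (∈-map⁺ corner (∈-allFin i))
  ∈-markers (inj₂ j) = ∈-++⁺ʳ (map corner (allFin n)) (∈-map⁺ edge (∈-allFin j))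

  firstFree : List (Marker n) → Marker n → List (Marker n) → Marker n
  firstFree h d [] = d
  firstFree h d (c ∷ cs) with c ∈? h
  ... | yes _ = firstFree h d cs
  ... | no _ = c

  firstFree-∉ : ∀ h d cs → Any (_∉ h) cs → firstFree h d cs ∉ h
  firstFree-∉ h d (c ∷ cs) free with c ∈? h | free
  ... | yes c∈h | here c∉h = ⊥-elim (c∉h c∈h)
  ... | yes _ | there free′ = firstFree-∉ h d cs free′
  ... | no c∉h | _ = c∉h

  firstFree-head : ∀ h d c cs → c ∉ h → firstFree h d (c ∷ cs) ≡ c
  firstFree-head h d c cs c∉h with c ∈? h
  ... | yes c∈h = ⊥-elim (c∉h c∈h)
  ... | no _ = refl

-- Any rule proposing a candidate move extends to a legal strategy: play the
-- candidate if it is free and otherwise some free marker.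
module Fallback {n : ℕ} (cand : List (Marker n) → Marker n) where

  σ : WhiteStrategy n
  σ h = firstFree h (cand h) (cand h ∷ markers)

  σ-legal : StrategyLegal σ
  σ-legal h _ _ _ (y , y∉h) =
    firstFree-∉ h (cand h) (cand h ∷ markers)
      (there (Any.map (λ { refl → y∉h }) (∈-markers y)))

  σ-plays-cand : ∀ h → cand h ∉ h → σ h ≡ cand h
  σ-plays-cand h = firstFree-head h (cand h) (cand h) markers

module Pairing {n : ℕ} (σ : WhiteStrategy n) (cand : List (Marker n) → Marker n)
  (σ-plays-cand : ∀ h → cand h ∉ h → σ h ≡ cand h) where

  Responds : Marker n → Marker n → Marker n → Set
  Responds x Y Z = ∀ zs → cand (x ∷ (zs ∷ʳ Y)) ≡ Z

  record MatedPair (x A B : Marker n) : Set where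
    field
      A≢x : A ≢ x
      B≢x : B ≢ x
      A≢B : A ≢ B
      A↦B : Responds x A B
      B↦A : Responds x B A

  -- If Y is claimed (after the first move) before Z and the rule answers Y
  -- by Z, then White claims Y or Z: if Black took Y, White's very next move
  -- is the still free candidate Z.
  answered : ∀ {x h'} → Legal (x ∷ h') → ConsistentWith σ (x ∷ h') →
    ∀ {Y Z} → Y ≢ x → Responds x Y Z →
    (i j : Fin (length (x ∷ h'))) → toℕ i < toℕ j →
    lookup (x ∷ h') i ≡ Y → lookup (x ∷ h') j ≡ Z →
    WhiteClaimed (x ∷ h') Y ⊎ WhiteClaimed (x ∷ h') Z
  answered _ _ Y≢x _ zero _ _ refl _ = ⊥-elim (Y≢x refl)
  answered {x} {h'} legal consistent {Y} {Z} _ Y↦Z (suc i) j i<j eY eZ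
    with turn (suc (toℕ i))
  ... | white odd = inj₁ (suc i , odd , eY)
  ... | black odd = inj₂ (reply , reply-odd , white-move)
    where
      h before : List (Marker n)
      h = x ∷ h'
      before = x ∷ (take (toℕ i) h' ∷ʳ Y)

      bound : suc (suc (toℕ i)) < length h
      bound = ≤-trans (s≤s i<j) (toℕ<n j)

      reply : Fin (length h)
      reply = fromℕ< bound

      reply-odd : Odd (toℕ reply)
      reply-odd = subst Odd (sym (toℕ-fromℕ< bound)) odd

      history : take (suc (suc (toℕ i))) h ≡ before
      history = trans (take-suc h (suc i)) (cong (λ y → x ∷ (take (toℕ i) h' ∷ʳ y)) eY)

      Z-free : cand before ∉ before
      Z-free = subst₂ _∉_ (trans eZ (sym (Y↦Z _))) history (lookup-∉-take legal j i<j)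

      white-move : lookup h reply ≡ Z
      white-move = begin
        lookup h reply                   ≡⟨ consistent reply reply-odd ⟩
        σ (take (toℕ reply) h)           ≡⟨ cong (λ k → σ (take k h)) (toℕ-fromℕ< bound) ⟩
        σ (take (suc (suc (toℕ i))) h)   ≡⟨ cong σ history ⟩
        σ before                         ≡⟨ σ-plays-cand before Z-free ⟩
        cand before                      ≡⟨ Y↦Z _ ⟩
        Z                                ∎

  pairing : ∀ {x h'} → Legal (x ∷ h') → ConsistentWith σ (x ∷ h') → Complete (x ∷ h') →
    ∀ {A B} → MatedPair x A B → WhiteClaimed (x ∷ h') A ⊎ WhiteClaimed (x ∷ h') B
  pairing {x} {h'} legal consistent complete {A} {B} mated =
    compare (index (complete A)) (index (complete B))
      (sym (lookup-index (complete A))) (sym (lookup-index (complete B)))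
    where
      open MatedPair mated
      compare : (i j : Fin (length (x ∷ h'))) → lookup (x ∷ h') i ≡ A → lookup (x ∷ h') j ≡ B →
        WhiteClaimed (x ∷ h') A ⊎ WhiteClaimed (x ∷ h') B
      compare i j eA eB with <-cmp (toℕ i) (toℕ j)
      ... | tri< i<j _ _ = answered legal consistent A≢x A↦B i j i<j eA eB
      ... | tri> _ _ j<i = swap (answered legal consistent B≢x B↦A j i j<i eB eA)
      ... | tri≈ _ i≡j _ =
        ⊥-elim (A≢B (trans (sym eA) (trans (cong (lookup (x ∷ h')) (toℕ-injective i≡j)) eB)))

-- Arithmetic of the path: deleting position q renumbers the others by
-- punchOut q (inverse punchIn q); twin pairs 2s with 2s+1.
twice : ℕ → ℕ
twice zero = zero
twice (suc s) = suc (suc (twice s))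

twin : ℕ → ℕ
twin zero = 1
twin (suc zero) = 0
twin (suc (suc s)) = suc (suc (twin s))

twin-twice : ∀ s → twin (twice s) ≡ suc (twice s)
twin-twice zero = refl
twin-twice (suc s) = cong (2 +_) (twin-twice s)

twin-involutive : ∀ s → twin (twin s) ≡ s
twin-involutive zero = refl
twin-involutive (suc zero) = refl
twin-involutive (suc (suc s)) = cong (2 +_) (twin-involutive s)

twin-≢ : ∀ s → twin s ≢ s
twin-≢ zero ()
twin-≢ (suc zero) ()
twin-≢ (suc (suc s)) eq = twin-≢ s (suc-injective (suc-injective eq))

punchOut : ℕ → ℕ → ℕ
punchOut zero r = pred r
punchOut (suc q) zero = zero
punchOut (suc q) (suc r) = suc (punchOut q r)

punchIn : ℕ → ℕ → ℕ
punchIn zero s = suc s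
punchIn (suc q) zero = zero
punchIn (suc q) (suc s) = suc (punchIn q s)

punchIn-punchOut : ∀ {q r} → r ≢ q → punchIn q (punchOut q r) ≡ r
punchIn-punchOut {zero} {zero} r≢q = ⊥-elim (r≢q refl)
punchIn-punchOut {zero} {suc r} _ = refl
punchIn-punchOut {suc q} {zero} _ = refl
punchIn-punchOut {suc q} {suc r} r≢q = cong suc (punchIn-punchOut (r≢q ∘ cong suc))

punchOut-below : ∀ {q r} → r < q → punchOut q r ≡ r
punchOut-below {suc q} {zero} _ = refl
punchOut-below {suc q} {suc r} (s≤s r<q) = cong suc (punchOut-below r<q)

punchOut-above : ∀ {q r} → q ≤ r → punchOut q (suc r) ≡ r
punchOut-above {zero} _ = refl
punchOut-above {suc q} {suc r} (s≤s q≤r) = cong suc (punchOut-above q≤r)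

mate : ℕ → ℕ → ℕ
mate q r = punchIn q (twin (punchOut q r))

mates : ∀ {q a b} → a ≢ q → b ≢ q → punchOut q b ≡ twin (punchOut q a) →
  mate q a ≡ b × mate q b ≡ a
mates {q} {a} {b} a≢q b≢q twins =
  (begin
    punchIn q (twin (punchOut q a))         ≡⟨ cong (punchIn q) (sym twins) ⟩
    punchIn q (punchOut q b)                ≡⟨ punchIn-punchOut b≢q ⟩
    b                                       ∎) ,
  (begin
    punchIn q (twin (punchOut q b))         ≡⟨ cong (punchIn q ∘ twin) twins ⟩
    punchIn q (twin (twin (punchOut q a)))  ≡⟨ cong (punchIn q) (twin-involutive _) ⟩
    punchIn q (punchOut q a)                ≡⟨ punchIn-punchOut a≢q ⟩
    a                                       ∎)

-- The three markers c_j, m_j, c_{j+1} of an edge group sit at the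
-- consecutive positions 2t, 2t+1, 2t+2.
data Slot : Set where
  lo ed hi : Slot

slotPos : ℕ → Slot → ℕ
slotPos t lo = twice t
slotPos t ed = suc (twice t)
slotPos t hi = suc (suc (twice t))

record MatedSlots (q t : ℕ) : Set where
  constructor matedSlots
  field
    a b : Slot
    a≢q : slotPos t a ≢ q
    b≢q : slotPos t b ≢ q
    twins : punchOut q (slotPos t b) ≡ twin (punchOut q (slotPos t a))

becomeTwins : ∀ {q a b} s → punchOut q a ≡ twice s → punchOut q b ≡ suc (twice s) →
  punchOut q b ≡ twin (punchOut q a)
becomeTwins {q} {a} {b} s pa pb = begin
  punchOut q b        ≡⟨ pb ⟩
  suc (twice s)       ≡⟨ sym (twin-twice s) ⟩
  twin (twice s)      ≡⟨ cong twin (sym pa) ⟩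
  twin (punchOut q a) ∎

-- Every edge group contains a mated pair: the lower two slots if q lies
-- above the group's edge marker, the upper two if below, the two corners
-- if q is the edge marker itself.
groupMates : ∀ q t → MatedSlots q t
groupMates q t with <-cmp (suc (twice t)) q
... | tri< m<q _ _ = matedSlots lo ed (<⇒≢ (<-trans (n<1+n _) m<q)) (<⇒≢ m<q)
  (becomeTwins {q = q} t (punchOut-below (<-trans (n<1+n _) m<q)) (punchOut-below m<q))
... | tri> _ _ q<m = matedSlots ed hi (>⇒≢ q<m) (>⇒≢ (<-trans q<m (n<1+n _)))
  (becomeTwins {q = q} t (punchOut-above (s≤s⁻¹ q<m)) (punchOut-above (<⇒≤ q<m)))
... | tri≈ _ refl _ = matedSlots lo hi (<⇒≢ (n<1+n _)) (>⇒≢ (n<1+n _))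
  (becomeTwins {q = suc (twice t)} {a = twice t} {b = suc (suc (twice t))} t
    (punchOut-below (n<1+n _)) (punchOut-above ≤-refl))

pos : ∀ {n} → Marker n → ℕ
pos (inj₁ i) = twice (toℕ i)
pos (inj₂ j) = suc (twice (toℕ j))

-- The marker at a given position (positions beyond the path are clamped).
marker : (m : ℕ) → ℕ → Marker (suc (suc m))
marker m zero = corner zero
marker m (suc zero) = edge zero
marker zero (suc (suc r)) = corner (suc zero)
marker (suc m) (suc (suc r)) = Sum.map suc suc (marker m r)

marker-pos : ∀ m (y : Marker (suc (suc m))) → marker m (pos y) ≡ y
marker-pos m (inj₁ zero) = refl
marker-pos zero (inj₁ (suc zero)) = refl
marker-pos (suc m) (inj₁ (suc i)) = cong (Sum.map suc suc) (marker-pos m (inj₁ i))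
marker-pos m (inj₂ zero) = refl
marker-pos (suc m) (inj₂ (suc j)) = cong (Sum.map suc suc) (marker-pos m (inj₂ j))

slotMarker : ∀ {m} → Fin (suc m) → Slot → Marker (suc (suc m))
slotMarker j lo = corner (loCorner j)
slotMarker j ed = edge j
slotMarker j hi = corner (hiCorner j)

slotMarker-∈ : ∀ {m} (j : Fin (suc m)) s → slotMarker j s ∈G edgeGrp j
slotMarker-∈ j lo = inj₁ refl
slotMarker-∈ j ed = inj₂ (inj₁ refl)
slotMarker-∈ j hi = inj₂ (inj₂ refl)

pos-slotMarker : ∀ {m} (j : Fin (suc m)) s → pos (slotMarker j s) ≡ slotPos (toℕ j) s
pos-slotMarker j lo = cong twice (toℕ-inject₁ j)
pos-slotMarker j ed = refl
pos-slotMarker j hi = refl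

module CycleStrategy (m : ℕ) where

  M : Set
  M = Marker (suc (suc m))

  first : M → M
  first (inj₁ zero) = corner (fromℕ (suc m))
  first (inj₁ (suc i)) = corner zero
  first (inj₂ j) = corner zero

  first-≢ : ∀ x → first x ≢ x
  first-≢ (inj₁ zero) ()
  first-≢ (inj₁ (suc i)) ()
  first-≢ (inj₂ j) ()

  first-∈-closing : ∀ x → first x ∈G closing
  first-∈-closing (inj₁ zero) = inj₂ refl
  first-∈-closing (inj₁ (suc i)) = inj₁ refl
  first-∈-closing (inj₂ j) = inj₁ refl

  partner : M → M → M
  partner x y = marker m (mate (pos x) (pos y))

  lastOr : M → List M → M
  lastOr d [] = d
  lastOr d (y ∷ ys) = lastOr y ys

  lastOr-∷ʳ : ∀ d zs y → lastOr d (zs ∷ʳ y) ≡ y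
  lastOr-∷ʳ d [] y = refl
  lastOr-∷ʳ d (z ∷ zs) y = lastOr-∷ʳ z zs y

  cand : List M → M
  cand [] = corner zero
  cand (x ∷ []) = first x
  cand (x ∷ y ∷ ys) = partner x (lastOr y ys)

  cand-partner : ∀ x zs y → cand (x ∷ (zs ∷ʳ y)) ≡ partner x y
  cand-partner x [] y = refl
  cand-partner x (z ∷ zs) y = cong (partner x) (lastOr-∷ʳ z zs y)

  open Fallback cand public using (σ; σ-legal; σ-plays-cand)
  open Pairing σ cand σ-plays-cand

  matedPair : ∀ {x A B} → pos A ≢ pos x → pos B ≢ pos x →
    punchOut (pos x) (pos B) ≡ twin (punchOut (pos x) (pos A)) → MatedPair x A B
  matedPair {x} {A} {B} A≢x B≢x twins = record
    { A≢x = A≢x ∘ cong pos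
    ; B≢x = B≢x ∘ cong pos
    ; A≢B = λ { refl → twin-≢ _ (sym twins) }
    ; A↦B = λ zs → trans (cand-partner x zs A) (answer A (proj₁ (mates A≢x B≢x twins)))
    ; B↦A = λ zs → trans (cand-partner x zs B) (answer B (proj₂ (mates A≢x B≢x twins)))
    }
    where
      answer : ∀ Y {Z} → mate (pos x) (pos Y) ≡ pos Z → partner x Y ≡ Z
      answer Y {Z} eq = trans (cong (marker m) eq) (marker-pos m Z)

  edgeMates : (x : M) (j : Fin (suc m)) →
    Σ Slot λ a → Σ Slot λ b → MatedPair x (slotMarker j a) (slotMarker j b)
  edgeMates x j with groupMates (pos x) (toℕ j)
  ... | matedSlots a b a≢q b≢q twins = a , b , matedPair
    (a≢q ∘ trans (sym (pos-slotMarker j a)))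
    (b≢q ∘ trans (sym (pos-slotMarker j b)))
    (subst₂ (λ u v → punchOut (pos x) v ≡ twin (punchOut (pos x) u))
      (sym (pos-slotMarker j a)) (sym (pos-slotMarker j b)) twins)

  closingWin : ∀ h → ConsistentWith σ h → Complete h →
    ∃ λ y → y ∈G closing × WhiteClaimed h y
  closingWin [] _ complete with complete (corner zero)
  ... | ()
  closingWin (x ∷ []) _ complete with complete (first x)
  ... | here eq = ⊥-elim (first-≢ x eq)
  closingWin (x ∷ y ∷ h) consistent _ = first x , first-∈-closing x , suc zero , refl ,
    trans (consistent (suc zero) refl) (σ-plays-cand (x ∷ []) first-free)
    where
      first-free : first x ∉ x ∷ []
      first-free (here eq) = first-≢ x eq

  edgeWin : ∀ h → Legal h → ConsistentWith σ h → Complete h → ∀ j →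
    ∃ λ y → y ∈G edgeGrp j × WhiteClaimed h y
  edgeWin [] _ _ complete j with complete (corner zero)
  ... | ()
  edgeWin (x ∷ h) legal consistent complete j with edgeMates x j
  ... | a , b , pair =
    [ (λ w → slotMarker j a , slotMarker-∈ j a , w) , (λ w → slotMarker j b , slotMarker-∈ j b , w) ]′
      (pairing legal consistent complete pair)

  σ-wins : StrategyWins σ
  σ-wins h _ consistent complete closing = closingWin h consistent complete
  σ-wins h legal consistent complete (edgeGrp j) = edgeWin h legal consistent complete j

mainTheorem1 : (n : ℕ) → 3 ≤ n →
    Σ (WhiteStrategy n) (λ σ → StrategyLegal σ × StrategyWins σ)
mainTheorem1 (suc (suc (suc k))) (s≤s (s≤s (s≤s z≤n))) = σ , σ-legal , σ-wins
  where open CycleStrategy (suc k)
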